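{- Let $G$ be a prime graph that is not sequentially $3$-rank-connected, and let $T_1,\dots,T_n$ be pairwise disjoint $3$-element subsets of $V(G)$ with $\rho_G(T_i)=2$ for each $i$. Then there is a subset $A\subseteq V(G)$ such that $\rho_G(A)\le 2$, neither $A$ nor $V(G)-A$ is sequential in $G$, and for each $1\le i\le n$, $T_i\subseteq A$ or $T_i\subseteq V(G)-A$.
   Context: Graphs are finite and simple. The cut-rank $\rho_G(X)$ of $X\subseteq V(G)$ is the $\mathrm{GF}(2)$-rank of the $X\times(V(G)-X)$ submatrix of the adjacency matrix. $G$ is prime if there is no partition $(A,B)$ of $V(G)$ with $|A|,|B|\ge2$ and $\rho_G(A)\le1$. A set $A$ is sequential in $G$ if it has an ordering $a_1,\dots,a_{|A|}$ with $\rho_G(\{a_1,\dots,a_i\})\le2$ for all $i$; $G$ is sequentially $3$-rank-connected if it is prime and for every $X$ with $\rho_G(X)\le 2$, $X$ or $V(G)-X$ is sequential in $G$. -}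

module Defs where

open import Data.Bool using (Bool; true; false; not; _∧_; _xor_; if_then_else_)
open import Data.Nat using (ℕ; zero; suc)
open import Data.Fin using (Fin; zero; suc; _≟_)
open import Data.List using (List; take)
open import Data.Bool.ListAction using (any)
open import Data.List.Relation.Unary.Unique.Propositional using (Unique)
open import Data.List.Membership.Propositional using (_∈_)
open import Data.Product using (Σ; _×_; ∃; ∃-syntax)
open import Data.Sum using (_⊎_)
open import Relation.Nullary using (¬_)
open import Relation.Nullary.Decidable using (⌊_⌋)
open import Relation.Binary.PropositionalEquality using (_≡_; _≢_)
open import Function.Bundles using (_⇔_)

record Graph : Set where
  field
    N     : ℕ
    adj   : Fin N → Fin N → Bool
    sym   : ∀ u v → adj u v ≡ adj v u
    irrefl : ∀ v → adj v v ≡ false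
open Graph public

VSet : Graph → Set
VSet G = Fin (N G) → Bool

complement : (G : Graph) → VSet G → VSet G
complement G X v = not (X v)

xorSum : ∀ {k} → (Fin k → Bool) → Bool
xorSum {zero} f = false
xorSum {suc k} f = f zero xor xorSum (λ i → f (suc i))

-- Row of the X × (V−X) submatrix of the adjacency matrix indexed by x,
-- viewed as a vector in GF(2)^(V−X) (entries at columns in X are omitted,
-- here represented as 0, which does not affect linear (in)dependence).
cutRow : (G : Graph) → VSet G → Fin (N G) → Fin (N G) → Bool
cutRow G X x y = not (X y) ∧ adj G x y

-- The X × (V−X) submatrix has k linearly independent rows (over GF(2)),
-- i.e. its rank is at least k.
CutRankGe : (G : Graph) → VSet G → ℕ → Set
CutRankGe G X k =
  Σ (Fin k → Fin (N G)) λ r →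
    (∀ i → X (r i) ≡ true) ×
    (∀ (c : Fin k → Bool) → (∃[ i ] c i ≡ true) →
       ∃[ y ] xorSum (λ i → c i ∧ cutRow G X (r i) y) ≡ true)

CutRankLe : (G : Graph) → VSet G → ℕ → Set
CutRankLe G X k = ¬ CutRankGe G X (suc k)

CutRankEq : (G : Graph) → VSet G → ℕ → Set
CutRankEq G X k = CutRankGe G X k × CutRankLe G X k

AtLeastTwo : (G : Graph) → VSet G → Set
AtLeastTwo G X = Σ (Fin (N G)) λ u → Σ (Fin (N G)) λ v → u ≢ v × X u ≡ true × X v ≡ true

Prime : Graph → Set
Prime G = ¬ (Σ (VSet G) λ A →
  AtLeastTwo G A × AtLeastTwo G (complement G A) × CutRankLe G A 1)

listSet : (G : Graph) → List (Fin (N G)) → VSet G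
listSet G l v = any (λ u → ⌊ u ≟ v ⌋) l

Sequential : (G : Graph) → VSet G → Set
Sequential G A = Σ (List (Fin (N G))) λ l →
  Unique l × (∀ v → (A v ≡ true) ⇔ (v ∈ l)) ×
  (∀ i → CutRankLe G (listSet G (take i l)) 2)

Seq3RankConnected : Graph → Set
Seq3RankConnected G = Prime G ×
  (∀ (X : VSet G) → CutRankLe G X 2 → Sequential G X ⊎ Sequential G (complement G X))

tripleSet : (G : Graph) → (Fin 3 → Fin (N G)) → VSet G
tripleSet G t v = ⌊ t zero ≟ v ⌋ Data.Bool.∨ (⌊ t (suc zero) ≟ v ⌋ Data.Bool.∨ ⌊ t (suc (suc zero)) ≟ v ⌋)

{-# OPTIONS --safe #-}

-- A set X has cut-rank at most 2 exactly when the X × (V − X) adjacency matrix factors through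
-- GF(2)². This makes "ρ ≤ 2" decidable and invariant under complementation, and a computation in
-- GF(2)⁴ gives the submodular consequence ρ(A ∩ B) ≤ 2 whenever ρ(A), ρ(B) ≤ 2 and ρ(A ∪ B) ≥ 2.
-- Everything in sight is decidable, so a prime graph that is not sequentially 3-rank-connected
-- has a set X with ρ(X) ≤ 2 that is non-sequential on both sides. The triples are then made
-- uniform one at a time: if T meets both sides, complement X if necessary so that two elements of
-- T lie in X, and add the third element t. Primeness and submodularity give ρ(X ∪ {t}) ≤ 2;
-- X ∪ {t} stays non-sequential since sequentiality survives deleting an element (submodularity
-- on prefixes), and V − (X ∪ {t}) since it survives adding one. Up to complement, X changes only
-- at t, so triples made uniform earlier stay uniform.

module Submission where

open import Defs hiding (sym)
open import Data.Bool using (Bool; true; false; not; _∧_; _∨_; _xor_; if_then_else_)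
open import Data.Bool.Properties
  using ( ∨-∧-booleanAlgebra; ∨-assoc; ∨-zeroʳ; ∨-identityʳ; ∨-conicalˡ; ∨-conicalʳ
        ; ∧-comm; ∧-zeroʳ; ∧-identityʳ; ∧-conicalˡ; ∧-conicalʳ
        ; xor-identityʳ; xor-same; ¬-not; not-involutive; not-injective )
  renaming (_≟_ to _≟ᵇ_)
open import Algebra.Lattice.Properties.BooleanAlgebra ∨-∧-booleanAlgebra using (deMorgan₁)
open import Data.Nat using (ℕ; zero; suc; _≤_; s≤s)
import Data.Nat.Properties as ℕ
open import Data.Fin using (Fin; zero; suc; _≟_; punchIn; punchOut; toℕ; fromℕ<)
open import Data.Fin.Properties
  using (any?; all?; ¬∀⟶∃¬; pigeonhole; <⇒≢; toℕ-fromℕ<; suc-injective; punchIn-injective; punchIn-punchOut)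
open import Data.Fin.Subset using (Subset)
open import Data.Fin.Subset.Properties using (anySubset?)
open import Data.Vec using ([]; _∷_; lookup; tabulate)
open import Data.Vec.Properties using (lookup∘tabulate)
open import Data.Vec.Functional using () renaming ([] to []ᶠ; _∷_ to _∷ᶠ_)
open import Data.List using (List; []; _∷_; _++_; take; drop; length; filter; cartesianProduct)
import Data.List as List
open import Data.List.Properties using (take-[]; filter-accept; filter-reject)
open import Data.List.Relation.Unary.Any using (here; there)
open import Data.List.Relation.Unary.All using ([]; _∷_)
import Data.List.Relation.Unary.All as All
open import Data.List.Relation.Unary.AllPairs using ([]; _∷_)
open import Data.List.Relation.Unary.Unique.Propositional using (Unique)
import Data.List.Relation.Unary.Unique.Propositional.Properties as Unique
import Data.List.Relation.Unary.Unique.DecPropositional as UniqueDec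
open import Data.List.Membership.Propositional using (_∈_)
open import Data.List.Membership.Propositional.Properties using (∈-lookup)
open import Data.Product using (Σ; _×_; _,_; proj₁; proj₂; ∃; curry; uncurry)
open import Data.Product.Properties using (≡-dec)
open import Data.Sum using (_⊎_; inj₁; inj₂) renaming (map to map-⊎)
open import Function.Bundles using (mk⇔; module Equivalence)
open import Relation.Nullary using (¬_; Dec; yes; no; contradiction)
open import Relation.Nullary.Decidable
  using (⌊_⌋; from-yes; map′; ¬?; decidable-stable; _×-dec_; _→-dec_)
open import Relation.Unary using (Decidable)
open import Relation.Binary using (DecidableEquality)
open import Relation.Binary.PropositionalEquality
  using (_≡_; _≢_; _≗_; refl; sym; trans; cong; cong₂; subst; module ≡-Reasoning)

-- Linear algebra over GF(2)

GF2² : Set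
GF2² = Bool × Bool

GF2⁴ : Set
GF2⁴ = GF2² × GF2²

_≟₂_ : DecidableEquality GF2²
_≟₂_ = ≡-dec _≟ᵇ_ _≟ᵇ_

_≟₄_ : DecidableEquality GF2⁴
_≟₄_ = ≡-dec _≟₂_ _≟₂_

infix 7 _·₂_ _·₄_

_·₂_ : GF2² → GF2² → Bool
(a , b) ·₂ (c , d) = (a ∧ c) xor (b ∧ d)

_·₄_ : GF2⁴ → GF2⁴ → Bool
(p , q) ·₄ (r , s) = p ·₂ r xor q ·₂ s

0₂ : GF2²
0₂ = false , false

0₄ : GF2⁴
0₄ = 0₂ , 0₂

_⊕₄_ : GF2⁴ → GF2⁴ → GF2⁴
((a , b) , (c , d)) ⊕₄ ((a′ , b′) , (c′ , d′)) = ((a xor a′) , (b xor b′)) , ((c xor c′) , (d xor d′))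

_⊙₄_ : Bool → GF2⁴ → GF2⁴
true  ⊙₄ v = v
false ⊙₄ v = 0₄

lincomb : GF2² → GF2⁴ → GF2⁴ → GF2⁴
lincomb (c , d) u v = (c ⊙₄ u) ⊕₄ (d ⊙₄ v)

·₂-comm : ∀ p q → p ·₂ q ≡ q ·₂ p
·₂-comm (a , b) (c , d) = cong₂ _xor_ (∧-comm a c) (∧-comm b d)

·₂-zeroʳ : ∀ p → p ·₂ 0₂ ≡ false
·₂-zeroʳ (a , b) = cong₂ _xor_ (∧-zeroʳ a) (∧-zeroʳ b)

·₄-zeroʳ : ∀ p → p ·₄ 0₄ ≡ false
·₄-zeroʳ (p , q) = cong₂ _xor_ (·₂-zeroʳ p) (·₂-zeroʳ q)

·₄-nonzero : ∀ p h → p ·₄ h ≡ true → h ≢ 0₄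
·₄-nonzero p h ph≡true refl = contradiction (trans (sym ph≡true) (·₄-zeroʳ p)) λ ()

∀ᵇ? : {P : Bool → Set} → Decidable P → Dec (∀ b → P b)
∀ᵇ? P? = map′ (λ (f , t) → λ { false → f ; true → t }) (λ h → h false , h true) (P? false ×-dec P? true)

∀₂? : {P : GF2² → Set} → Decidable P → Dec (∀ p → P p)
∀₂? P? = map′ uncurry curry (∀ᵇ? λ a → ∀ᵇ? λ b → P? (a , b))

∀₄? : {P : GF2⁴ → Set} → Decidable P → Dec (∀ p → P p)
∀₄? P? = map′ uncurry curry (∀₂? λ a → ∀₂? λ b → P? (a , b))

xorSum-cong : ∀ {k} {f g : Fin k → Bool} → f ≗ g → xorSum f ≡ xorSum g
xorSum-cong {zero}  f≗g = refl
xorSum-cong {suc k} f≗g = cong₂ _xor_ (f≗g zero) (xorSum-cong (λ i → f≗g (suc i)))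

xorSum-false : ∀ {k} → xorSum {k} (λ _ → false) ≡ false
xorSum-false {zero}  = refl
xorSum-false {suc k} = xorSum-false {k}

xor-≢ : ∀ {a b} → a ≢ b → a xor b ≡ true
xor-≢ {true}  {false} _ = refl
xor-≢ {false} {true}  _ = refl
xor-≢ {true}  {true}  a≢b = contradiction refl a≢b
xor-≢ {false} {false} a≢b = contradiction refl a≢b

module _ (h₁ h₂ : GF2⁴) where

  private
    allGF2² : List GF2²
    allGF2² = (false , false) ∷ (false , true) ∷ (true , false) ∷ (true , true) ∷ []

    head : {A : Set} → A → List A → A
    head d []      = d
    head d (x ∷ _) = x

    orthogonalNonzero : List GF2⁴
    orthogonalNonzero = filter (λ q → ¬? (q ≟₄ 0₄) ×-dec (q ·₄ h₁ ≟ᵇ false) ×-dec (q ·₄ h₂ ≟ᵇ false))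
                               (cartesianProduct allGF2² allGF2²)

  -- When h₁ and h₂ are distinct and nonzero, {h₁, h₂}⊥ is a plane and its first
  -- two nonzero vectors (in a fixed enumeration) form a basis.
  ⊥-basis₁ ⊥-basis₂ : GF2⁴
  ⊥-basis₁ = head 0₄ orthogonalNonzero
  ⊥-basis₂ = head 0₄ (drop 1 orthogonalNonzero)

  ⊥-coordinates : GF2⁴ → GF2²
  ⊥-coordinates q = head 0₂ (filter (λ c → q ≟₄ lincomb c ⊥-basis₁ ⊥-basis₂) allGF2²)

-- Kept abstract: these are proved by evaluation, and unfolding them on open terms is
-- prohibitively expensive.
abstract
  ·₄-lincomb : ∀ c u v w → lincomb c u v ·₄ w ≡ c ·₂ (u ·₄ w , v ·₄ w)
  ·₄-lincomb = from-yes (∀₂? λ c → ∀₄? λ u → ∀₄? λ v → ∀₄? λ w → lincomb c u v ·₄ w ≟ᵇ c ·₂ (u ·₄ w , v ·₄ w))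

  three-dependentᵛ : ∀ p₀ p₁ p₂ → ∃ λ (c : Subset 3) → (∃ λ i → lookup c i ≡ true) ×
    ∀ q → xorSum (λ i → lookup c i ∧ lookup (p₀ ∷ p₁ ∷ p₂ ∷ []) i ·₂ q) ≡ false
  three-dependentᵛ = from-yes (∀₂? λ p₀ → ∀₂? λ p₁ → ∀₂? λ p₂ → anySubset? λ c →
    any? (λ i → lookup c i ≟ᵇ true) ×-dec
    ∀₂? (λ q → xorSum (λ i → lookup c i ∧ lookup (p₀ ∷ p₁ ∷ p₂ ∷ []) i ·₂ q) ≟ᵇ false))

  ⊥-basis-spans : ∀ h₁ h₂ q → h₁ ≢ 0₄ → h₂ ≢ 0₄ → h₁ ≢ h₂ → q ·₄ h₁ ≡ false → q ·₄ h₂ ≡ false →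
    q ≡ lincomb (⊥-coordinates h₁ h₂ q) (⊥-basis₁ h₁ h₂) (⊥-basis₂ h₁ h₂)
  ⊥-basis-spans = from-yes (∀₄? λ h₁ → ∀₄? λ h₂ → ∀₄? λ q →
    ¬? (h₁ ≟₄ 0₄) →-dec ¬? (h₂ ≟₄ 0₄) →-dec ¬? (h₁ ≟₄ h₂) →-dec (q ·₄ h₁ ≟ᵇ false) →-dec (q ·₄ h₂ ≟ᵇ false) →-dec
    (q ≟₄ lincomb (⊥-coordinates h₁ h₂ q) (⊥-basis₁ h₁ h₂) (⊥-basis₂ h₁ h₂)))

three-dependent : ∀ (p : Fin 3 → GF2²) → ∃ λ (c : Fin 3 → Bool) → (∃ λ i → c i ≡ true) ×
  ∀ q → xorSum (λ i → c i ∧ p i ·₂ q) ≡ false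
three-dependent p =
  let c , c≢0 , c·p≡0 = three-dependentᵛ (p zero) (p (suc zero)) (p (suc (suc zero))) in
  lookup c , c≢0 , λ q → trans (xorSum-cong λ i → cong (λ pᵢ → lookup c i ∧ pᵢ ·₂ q) (p≡ i)) (c·p≡0 q)
  where
    p≡ : ∀ i → p i ≡ lookup (p zero ∷ p (suc zero) ∷ p (suc (suc zero)) ∷ []) i
    p≡ zero             = refl
    p≡ (suc zero)       = refl
    p≡ (suc (suc zero)) = refl

infixr 6 _∩_
infixr 5 _∪_

_∪_ _∩_ _∖_ : {A : Set} → (A → Bool) → (A → Bool) → A → Bool
(X ∪ Y) v = X v ∨ Y v
(X ∩ Y) v = X v ∧ Y v
(X ∖ Y) v = X v ∧ not (Y v)

⁅_⁆ : ∀ {n} → Fin n → Fin n → Bool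
⁅ u ⁆ v = ⌊ u ≟ v ⌋

⁅⁆-self : ∀ {n} (v : Fin n) → ⁅ v ⁆ v ≡ true
⁅⁆-self v with v ≟ v
... | yes _   = refl
... | no v≢v = contradiction refl v≢v

⁅⁆-other : ∀ {n} {u v : Fin n} → u ≢ v → ⁅ u ⁆ v ≡ false
⁅⁆-other {u = u} {v} u≢v with u ≟ v
... | yes u≡v = contradiction u≡v u≢v
... | no _    = refl

∨-introˡ : ∀ {a b} → a ≡ true → a ∨ b ≡ true
∨-introˡ refl = refl

∨-introʳ : ∀ {a b} → b ≡ true → a ∨ b ≡ true
∨-introʳ {a} refl = ∨-zeroʳ a

∨-∧-not : ∀ a b → (a ∨ b) ∧ not a ≡ b ∧ not a
∨-∧-not true  b = sym (∧-zeroʳ b)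
∨-∧-not false b = refl

infix 4 _⊆_

_⊆_ : {A : Set} → (A → Bool) → (A → Bool) → Set
X ⊆ Y = ∀ {v} → X v ≡ true → Y v ≡ true

∩-∖ : {A : Set} {P Z Y : A → Bool} → P ⊆ Z → (P ∩ (Z ∖ Y)) ≗ (P ∖ Y)
∩-∖ {P = P} {Z} {Y} P⊆Z v with P v in P∋?v
... | true  = cong (_∧ not (Y v)) (P⊆Z P∋?v)
... | false = refl

∪-∖ : {A : Set} {P Z Y : A → Bool} → P ⊆ Z → Y ⊆ P → (P ∪ (Z ∖ Y)) ≗ Z
∪-∖ {P = P} {Z} {Y} P⊆Z Y⊆P v with Y v in Y∋?v | P v in P∋?v
... | true  | true  = sym (P⊆Z P∋?v)
... | true  | false = contradiction (trans (sym (Y⊆P Y∋?v)) P∋?v) λ ()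
... | false | true  = sym (P⊆Z P∋?v)
... | false | false = ∧-identityʳ (Z v)

∖-⁅⁆-∉ : ∀ {n} {P : Fin n → Bool} {z} → P z ≡ false → (P ∖ ⁅ z ⁆) ≗ P
∖-⁅⁆-∉ {P = P} {z} P∌z v with z ≟ v
... | yes refl = trans (∧-zeroʳ (P z)) (sym P∌z)
... | no  _    = ∧-identityʳ (P v)

⁅⁆-⊆ : ∀ {n} {P : Fin n → Bool} {z} → P z ≡ true → ⁅ z ⁆ ⊆ P
⁅⁆-⊆ {z = z} P∋z {v} z≡v with z ≟ v
... | yes refl = P∋z

∪-⁅⁆-other : ∀ {n} {X : Fin n → Bool} {u v} → u ≢ v → (X ∪ ⁅ u ⁆) v ≡ X v
∪-⁅⁆-other {X = X} {v = v} u≢v = trans (cong (X v ∨_) (⁅⁆-other u≢v)) (∨-identityʳ (X v))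

∪-⁅⁆-∖-⁅⁆ : ∀ {n} {X : Fin n → Bool} {t} → X t ≡ false → ((X ∪ ⁅ t ⁆) ∖ ⁅ t ⁆) ≗ X
∪-⁅⁆-∖-⁅⁆ {X = X} {t} X∌t v with t ≟ v
... | yes refl = trans (∧-zeroʳ _) (sym X∌t)
... | no  _    = trans (∧-identityʳ _) (∨-identityʳ (X v))

∁-∪-⁅⁆-∪-⁅⁆ : ∀ {n} {X : Fin n → Bool} {t} → X t ≡ false →
  ((λ v → not ((X ∪ ⁅ t ⁆) v)) ∪ ⁅ t ⁆) ≗ (λ v → not (X v))
∁-∪-⁅⁆-∪-⁅⁆ {X = X} {t} X∌t v with t ≟ v
... | yes refl = trans (∨-zeroʳ _) (sym (cong not X∌t))
... | no  _    = trans (∨-identityʳ _) (cong not (∨-identityʳ (X v)))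

∪-absorbs : {A : Set} {X S Y : A → Bool} → S ⊆ (X ∪ Y) → Y ⊆ S → (X ∪ S) ≗ (X ∪ Y)
∪-absorbs {X = X} {S} {Y} S⊆X∪Y Y⊆S v with X v in X∋?v | S v in S∋?v | Y v in Y∋?v
... | true  | _     | _     = refl
... | false | true  | true  = refl
... | false | false | false = refl
... | false | true  | false = contradiction (trans (sym (S⊆X∪Y S∋?v)) (cong₂ _∨_ X∋?v Y∋?v)) λ ()
... | false | false | true  = contradiction (trans (sym (Y⊆S Y∋?v)) S∋?v) λ ()

odd-one-out : (b : Fin 3 → Bool) →
  (∀ a → b a ≡ true) ⊎ (∀ a → b a ≡ false) ⊎ ∃ λ k → ∀ j → b (punchIn k j) ≡ not (b k)
odd-one-out b with b zero in b₀ | b (suc zero) in b₁ | b (suc (suc zero)) in b₂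
... | true  | true  | true  = inj₁ λ { zero → b₀ ; (suc zero) → b₁ ; (suc (suc zero)) → b₂ }
... | false | false | false = inj₂ (inj₁ λ { zero → b₀ ; (suc zero) → b₁ ; (suc (suc zero)) → b₂ })
... | true  | true  | false = inj₂ (inj₂ (suc (suc zero) ,
    λ { zero → trans b₀ (cong not (sym b₂)) ; (suc zero) → trans b₁ (cong not (sym b₂)) }))
... | false | false | true  = inj₂ (inj₂ (suc (suc zero) ,
    λ { zero → trans b₀ (cong not (sym b₂)) ; (suc zero) → trans b₁ (cong not (sym b₂)) }))
... | true  | false | true  = inj₂ (inj₂ (suc zero ,
    λ { zero → trans b₀ (cong not (sym b₁)) ; (suc zero) → trans b₂ (cong not (sym b₁)) }))
... | false | true  | false = inj₂ (inj₂ (suc zero ,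
    λ { zero → trans b₀ (cong not (sym b₁)) ; (suc zero) → trans b₂ (cong not (sym b₁)) }))
... | false | true  | true  = inj₂ (inj₂ (zero ,
    λ { zero → trans b₁ (cong not (sym b₀)) ; (suc zero) → trans b₂ (cong not (sym b₀)) }))
... | true  | false | false = inj₂ (inj₂ (zero ,
    λ { zero → trans b₁ (cong not (sym b₀)) ; (suc zero) → trans b₂ (cong not (sym b₀)) }))

take-∷ʳ : ∀ {A : Set} i (l : List A) x → take i (l ++ x ∷ []) ≡ take i l ⊎ take i (l ++ x ∷ []) ≡ l ++ x ∷ []
take-∷ʳ zero    l       x = inj₁ refl
take-∷ʳ (suc i) []      x = inj₂ (cong (x ∷_) (take-[] i))
take-∷ʳ (suc i) (y ∷ l) x = map-⊎ (cong (y ∷_)) (cong (y ∷_)) (take-∷ʳ i l x)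

take-filter : ∀ {A : Set} {P : A → Set} (P? : Decidable P) i l → ∃ λ j → take i (filter P? l) ≡ filter P? (take j l)
take-filter P? zero    l       = zero , refl
take-filter P? (suc i) []      = zero , refl
take-filter P? (suc i) (x ∷ l) with P? x
... | yes Px = let j , eq = take-filter P? i l in suc j , trans (cong (x ∷_) eq) (sym (filter-accept P? Px))
... | no ¬Px = let j , eq = take-filter P? (suc i) l in suc j , trans eq (sym (filter-reject P? ¬Px))

all-prefixes? : {A : Set} {P : List A → Set} → (∀ l → Dec (P l)) → ∀ l → Dec (∀ i → P (take i l))
all-prefixes? {P = P} P? []      = map′ (λ p i → subst P (sym (take-[] i)) p) (λ h → h zero) (P? [])
all-prefixes? P? (x ∷ l) = map′ (λ (p , q) → λ { zero → p ; (suc i) → q i }) (λ h → h zero , λ i → h (suc i))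
                                (P? [] ×-dec all-prefixes? (λ m → P? (x ∷ m)) l)

∃-list-of-length? : ∀ {n} k {P : List (Fin n) → Set} → (∀ l → Dec (P l)) → Dec (∃ λ l → length l ≡ k × P l)
∃-list-of-length? zero    P? = map′ (λ p → [] , refl , p) (λ { ([] , _ , p) → p }) (P? [])
∃-list-of-length? (suc k) P? = map′ (λ (x , l , eq , p) → x ∷ l , cong suc eq , p)
                                    (λ { (x ∷ l , eq , p) → x , l , ℕ.suc-injective eq , p })
                                    (any? λ x → ∃-list-of-length? k λ l → P? (x ∷ l))

unique-lookup-injective : {A : Set} {l : List A} → Unique l → ∀ i j → List.lookup l i ≡ List.lookup l j → i ≡ j
unique-lookup-injective {l = x ∷ l} _         zero    zero    _  = refl
unique-lookup-injective {l = x ∷ l} (x∉l ∷ u) zero    (suc j) eq = contradiction eq (All.lookup x∉l (∈-lookup j))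
unique-lookup-injective {l = x ∷ l} (x∉l ∷ u) (suc i) zero    eq =
  contradiction (sym eq) (All.lookup x∉l (∈-lookup i))
unique-lookup-injective {l = x ∷ l} (x∉l ∷ u) (suc i) (suc j) eq = cong suc (unique-lookup-injective u i j eq)

unique-length≤ : ∀ {n} {l : List (Fin n)} → Unique l → length l ≤ n
unique-length≤ {n} {l} u with length l ℕ.≤? n
... | yes ≤n = ≤n
... | no  ≰n = let i , j , i<j , eq = pigeonhole (ℕ.≰⇒> ≰n) (List.lookup l) in
               contradiction (unique-lookup-injective u i j eq) (<⇒≢ i<j)

module _ (G : Graph) where

  private
    V : Set
    V = Fin (N G)

  -- Cut-rank at most two

  cutRow-outside : ∀ X x {y} → X y ≡ false → cutRow G X x y ≡ adj G x y
  cutRow-outside X x X∌y rewrite X∌y = refl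

  cutRow-inside : ∀ X x {y} → X y ≡ true → cutRow G X x y ≡ false
  cutRow-inside X x X∋y rewrite X∋y = refl

  combination-inside : ∀ {k} X (r : Fin k → V) (c : Fin k → Bool) {y} → X y ≡ true →
    xorSum (λ i → c i ∧ cutRow G X (r i) y) ≡ false
  combination-inside {k} X r c X∋y =
    trans (xorSum-cong λ i → trans (cong (c i ∧_) (cutRow-inside X (r i) X∋y)) (∧-zeroʳ _)) (xorSum-false {k})

  cutRows : ∀ {k} → VSet G → (Fin k → V) → Fin k → V → Bool
  cutRows X r i = cutRow G X (r i)

  IndependentRows : ∀ {k} → VSet G → (Fin k → V) → Set
  IndependentRows {k} X r = ∀ (c : Fin k → Bool) → (∃ λ i → c i ≡ true) →
    ∃ λ y → xorSum (λ i → c i ∧ cutRow G X (r i) y) ≡ true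

  InRowSpan : ∀ {k} → VSet G → (Fin k → V → Bool) → V → Set
  InRowSpan {k} X u x = ∃ λ (c : Fin k → Bool) → ∀ y → cutRow G X x y ≡ xorSum (λ i → c i ∧ u i y)

  RowsSpannedBy : ∀ {k} → VSet G → (Fin k → V → Bool) → Set
  RowsSpannedBy X u = ∀ x → X x ≡ false ⊎ InRowSpan X u x

  inRowSpan? : ∀ {k} X (u : Fin k → V → Bool) x → Dec (InRowSpan X u x)
  inRowSpan? X u x = map′ (λ (s , p) → lookup s , p) (λ (c , p) → tabulate c , λ y → trans (p y) (xorSum-cong λ i →
                       cong (_∧ u i y) (sym (lookup∘tabulate c i))))
                     (anySubset? λ s → all? λ y → cutRow G X x y ≟ᵇ xorSum (λ i → lookup s i ∧ u i y))

  independentRows-∷ : ∀ {k} X {r : Fin k → V} {x} → IndependentRows X r →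
    ¬ InRowSpan X (cutRows X r) x → IndependentRows X (x ∷ᶠ r)
  independentRows-∷ X {r} {x} ind x∉span c (i , cᵢ) with c zero in c₀ | i
  ... | true  | _ =
    let y , differs = ¬∀⟶∃¬ _ _ (λ y → cutRow G X x y ≟ᵇ _) (λ same → x∉span ((λ i → c (suc i)) , same)) in
    y , xor-≢ differs
  ... | false | zero  = contradiction (trans (sym cᵢ) c₀) λ ()
  ... | false | suc j = ind (λ i → c (suc i)) (j , cᵢ)

  spanned-or-extends : ∀ {k} X (r : Fin k → V) → (∀ i → X (r i) ≡ true) → IndependentRows X r →
    RowsSpannedBy X (cutRows X r) ⊎ CutRankGe G X (suc k)
  spanned-or-extends X r r⊆X ind with any? (λ x → (X x ≟ᵇ true) ×-dec ¬? (inRowSpan? X _ x))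
  ... | yes (x , X∋x , x∉span) =
    inj₂ (x ∷ᶠ r , (λ { zero → X∋x ; (suc i) → r⊆X i }) , independentRows-∷ X ind x∉span)
  ... | no none = inj₁ spanned
    where
      spanned : RowsSpannedBy X (cutRows X r)
      spanned x with X x ≟ᵇ true
      ... | no  X∌x = inj₁ (¬-not X∌x)
      ... | yes X∋x = inj₂ (decidable-stable (inRowSpan? X _ x) λ x∉span → none (x , X∋x , x∉span))

  Factorisation : VSet G → Set
  Factorisation X = Σ (V → GF2²) λ f → Σ (V → GF2²) λ g →
    ∀ x y → X x ≡ true → X y ≡ false → adj G x y ≡ f x ·₂ g y

  zeroRow : V → Bool
  zeroRow _ = false

  spannedBy-∷ : ∀ {k X} w (u : Fin k → V → Bool) → RowsSpannedBy X u → RowsSpannedBy X (w ∷ᶠ u)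
  spannedBy-∷ _ _ spanned x with spanned x
  ... | inj₁ X∌x       = inj₁ X∌x
  ... | inj₂ (c , x≡c) = inj₂ (false ∷ᶠ c , x≡c)

  spannedBy⇒factorisation : ∀ X (u : Fin 2 → V → Bool) → RowsSpannedBy X u → Factorisation X
  spannedBy⇒factorisation X u spanned = coefficients , (λ y → u zero y , u (suc zero) y) , factors
    where
      coefficients : V → GF2²
      coefficients x with spanned x
      ... | inj₁ _       = 0₂
      ... | inj₂ (c , _) = c zero , c (suc zero)

      factors : ∀ x y → X x ≡ true → X y ≡ false →
        adj G x y ≡ coefficients x ·₂ (u zero y , u (suc zero) y)
      factors x y X∋x X∌y with spanned x
      ... | inj₁ X∌x       = contradiction (trans (sym X∋x) X∌x) λ ()
      ... | inj₂ (c , x≡c) = trans (sym (cutRow-outside X x X∌y))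
                                   (trans (x≡c y) (cong ((c zero ∧ u zero y) xor_) (xor-identityʳ _)))

  -- Grow an independent family of rows until it spans all rows of X; a span of fewer than two
  -- rows is padded with zero rows.
  factorisation-or-cutRank≥3 : ∀ X → Factorisation X ⊎ CutRankGe G X 3
  factorisation-or-cutRank≥3 X with spanned-or-extends X []ᶠ (λ ()) (λ _ ())
  ... | inj₁ s₀ = inj₁ (spannedBy⇒factorisation X (zeroRow ∷ᶠ zeroRow ∷ᶠ cutRows X []ᶠ)
                         (spannedBy-∷ zeroRow (zeroRow ∷ᶠ cutRows X []ᶠ) (spannedBy-∷ zeroRow (cutRows X []ᶠ) s₀)))
  ... | inj₂ (r₁ , r₁⊆X , ind₁) with spanned-or-extends X r₁ r₁⊆X ind₁
  ...   | inj₁ s₁ =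
    inj₁ (spannedBy⇒factorisation X (zeroRow ∷ᶠ cutRows X r₁) (spannedBy-∷ zeroRow (cutRows X r₁) s₁))
  ...   | inj₂ (r₂ , r₂⊆X , ind₂) with spanned-or-extends X r₂ r₂⊆X ind₂
  ...     | inj₁ s₂  = inj₁ (spannedBy⇒factorisation X (cutRows X r₂) s₂)
  ...     | inj₂ ρ≥3 = inj₂ ρ≥3

  factorisation⇒cutRank≤2 : ∀ X → Factorisation X → CutRankLe G X 2
  factorisation⇒cutRank≤2 X (f , g , adj≡) (r , r⊆X , ind)
    with c , c≢0 , c·f≡0 ← three-dependent (λ i → f (r i))
    with y , sum≡true ← ind c c≢0
    = contradiction (trans (sym sum≡true) combination-vanishes) λ ()
    where
      combination-vanishes : xorSum (λ i → c i ∧ cutRow G X (r i) y) ≡ false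
      combination-vanishes with X y ≟ᵇ true
      ... | yes X∋y = combination-inside X r c X∋y
      ... | no  X∌y = trans (xorSum-cong λ i → cong (c i ∧_)
                              (trans (cutRow-outside X (r i) (¬-not X∌y)) (adj≡ (r i) y (r⊆X i) (¬-not X∌y))))
                            (c·f≡0 (g y))

  cutRank≤2⇒factorisation : ∀ X → CutRankLe G X 2 → Factorisation X
  cutRank≤2⇒factorisation X ρ≤2 with factorisation-or-cutRank≥3 X
  ... | inj₁ F   = F
  ... | inj₂ ρ≥3 = contradiction ρ≥3 ρ≤2

  cutRank≤2? : ∀ X → Dec (CutRankLe G X 2)
  cutRank≤2? X with factorisation-or-cutRank≥3 X
  ... | inj₁ F   = yes (factorisation⇒cutRank≤2 X F)
  ... | inj₂ ρ≥3 = no λ ρ≤2 → ρ≤2 ρ≥3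

  factorisation-complement : ∀ X → Factorisation X → Factorisation (complement G X)
  factorisation-complement X (f , g , adj≡) = g , f , λ x y X̅∋x X̅∌y →
    trans (Graph.sym G x y) (trans (adj≡ y x (not-injective X̅∌y) (not-injective X̅∋x)) (·₂-comm (f y) (g x)))

  cutRank≤2-complement : ∀ X → CutRankLe G X 2 → CutRankLe G (complement G X) 2
  cutRank≤2-complement X ρ≤2 =
    factorisation⇒cutRank≤2 _ (factorisation-complement X (cutRank≤2⇒factorisation X ρ≤2))

  cutRankGe-≗ : ∀ {X Y k} → X ≗ Y → CutRankGe G X k → CutRankGe G Y k
  cutRankGe-≗ X≗Y (r , r⊆X , ind) = r , (λ i → trans (sym (X≗Y (r i))) (r⊆X i)) , λ c c≢0 →
    let y , sum≡true = ind c c≢0 in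
    y , trans (xorSum-cong λ i → cong (λ b → c i ∧ (not b ∧ adj G (r i) y)) (sym (X≗Y y))) sum≡true

  cutRankLe-≗ : ∀ {X Y k} → X ≗ Y → CutRankLe G X k → CutRankLe G Y k
  cutRankLe-≗ X≗Y ρX≤k ρY>k = ρX≤k (cutRankGe-≗ (λ v → sym (X≗Y v)) ρY>k)

  record IndependentColumns (U : VSet G) (h : V → GF2⁴) : Set where
    field
      y₁ y₂   : V
      U∌y₁    : U y₁ ≡ false
      U∌y₂    : U y₂ ≡ false
      hy₁≢0   : h y₁ ≢ 0₄
      hy₂≢0   : h y₂ ≢ 0₄
      hy₁≢hy₂ : h y₁ ≢ h y₂

  independent-columns : ∀ U (P h : V → GF2⁴) → (∀ x y → U x ≡ true → U y ≡ false → adj G x y ≡ P x ·₄ h y) →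
    CutRankGe G U 2 → IndependentColumns U h
  independent-columns U P h adj≡ (u , u⊆U , ind) = record
    { y₁ = y₁ ; y₂ = y₂ ; U∌y₁ = proj₁ y₁-detected ; U∌y₂ = proj₁ y₂-detected
    ; hy₁≢0 = ·₄-nonzero (lincomb (true , false) p₀ p₁) (h y₁) (proj₂ y₁-detected)
    ; hy₂≢0 = ·₄-nonzero (lincomb (d , true) p₀ p₁) (h y₂) (proj₂ y₂-detected) ; hy₁≢hy₂ = hy₁≢hy₂ }
    where
      p₀ p₁ : GF2⁴
      p₀ = P (u zero)
      p₁ = P (u (suc zero))

      detect : ∀ c₀ c₁ y → xorSum (λ i → (c₀ ∷ᶠ c₁ ∷ᶠ []ᶠ) i ∧ cutRow G U (u i) y) ≡ true →
        U y ≡ false × lincomb (c₀ , c₁) p₀ p₁ ·₄ h y ≡ true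
      detect c₀ c₁ y sum≡true with U y ≟ᵇ true
      ... | yes U∋y = contradiction (trans (sym sum≡true) (combination-inside U u (c₀ ∷ᶠ c₁ ∷ᶠ []ᶠ) U∋y)) λ ()
      ... | no  U∌y = ¬-not U∌y , (begin
        lincomb (c₀ , c₁) p₀ p₁ ·₄ h y             ≡⟨ ·₄-lincomb (c₀ , c₁) p₀ p₁ (h y) ⟩
        (c₀ ∧ p₀ ·₄ h y) xor (c₁ ∧ p₁ ·₄ h y)
          ≡⟨ cong₂ (λ a b → (c₀ ∧ a) xor (c₁ ∧ b)) (sym (row≡ zero)) (sym (row≡ (suc zero))) ⟩
        (c₀ ∧ cutRow G U (u zero) y) xor (c₁ ∧ cutRow G U (u (suc zero)) y)
          ≡⟨ cong ((c₀ ∧ cutRow G U (u zero) y) xor_) (sym (xor-identityʳ _)) ⟩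
        xorSum (λ i → (c₀ ∷ᶠ c₁ ∷ᶠ []ᶠ) i ∧ cutRow G U (u i) y) ≡⟨ sum≡true ⟩
        true                                        ∎)
        where
          open ≡-Reasoning
          row≡ : ∀ i → cutRow G U (u i) y ≡ P (u i) ·₄ h y
          row≡ i = trans (cutRow-outside U (u i) (¬-not U∌y)) (adj≡ (u i) y (u⊆U i) (¬-not U∌y))

      y₁ : V
      y₁ = proj₁ (ind (true ∷ᶠ false ∷ᶠ []ᶠ) (zero , refl))

      d : Bool
      d = p₁ ·₄ h y₁

      y₂ : V
      y₂ = proj₁ (ind (d ∷ᶠ true ∷ᶠ []ᶠ) (suc zero , refl))

      y₁-detected : U y₁ ≡ false × lincomb (true , false) p₀ p₁ ·₄ h y₁ ≡ true
      y₁-detected = detect true false y₁ (proj₂ (ind (true ∷ᶠ false ∷ᶠ []ᶠ) (zero , refl)))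

      y₂-detected : U y₂ ≡ false × lincomb (d , true) p₀ p₁ ·₄ h y₂ ≡ true
      y₂-detected = detect d true y₂ (proj₂ (ind (d ∷ᶠ true ∷ᶠ []ᶠ) (suc zero , refl)))

      ℓ₂·hy₁≡false : lincomb (d , true) p₀ p₁ ·₄ h y₁ ≡ false
      ℓ₂·hy₁≡false = begin
        lincomb (d , true) p₀ p₁ ·₄ h y₁  ≡⟨ ·₄-lincomb (d , true) p₀ p₁ (h y₁) ⟩
        (d ∧ p₀ ·₄ h y₁) xor d           ≡⟨ cong (λ a → (d ∧ a) xor d) p₀·hy₁≡true ⟩
        (d ∧ true) xor d                 ≡⟨ cong (_xor d) (∧-identityʳ d) ⟩
        d xor d                          ≡⟨ xor-same d ⟩
        false                            ∎
        where
          open ≡-Reasoning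
          p₀·hy₁≡true : p₀ ·₄ h y₁ ≡ true
          p₀·hy₁≡true =
            trans (sym (trans (·₄-lincomb (true , false) p₀ p₁ (h y₁)) (xor-identityʳ _))) (proj₂ y₁-detected)

      hy₁≢hy₂ : h y₁ ≢ h y₂
      hy₁≢hy₂ hy₁≡hy₂ = contradiction
        (trans (sym (proj₂ y₂-detected)) (trans (cong (lincomb (d , true) p₀ p₁ ·₄_) (sym hy₁≡hy₂)) ℓ₂·hy₁≡false))
        λ ()

  -- Together the two factorisations factor A ∩ B through GF(2)⁴ (rows q, columns H). Every row
  -- q x is orthogonal to the columns h y of V − (A ∪ B), which span a plane because ρ(A ∪ B) ≥ 2,
  -- so the rows lie in the plane {h y₁, h y₂}⊥.
  factorisation-∩ : ∀ A B → Factorisation A → Factorisation B → CutRankGe G (A ∪ B) 2 → Factorisation (A ∩ B)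
  factorisation-∩ A B (f₁ , g₁ , adj≡₁) (f₂ , g₂ , adj≡₂) ρ∪≥2 =
    coordinates , (λ y → b₁ ·₄ H y , b₂ ·₄ H y) , factors
    where
      P h H q : V → GF2⁴
      P x = if A x then (f₁ x , 0₂) else (0₂ , f₂ x)
      h y = g₁ y , g₂ y
      H y = if A y then (0₂ , g₂ y) else (g₁ y , 0₂)
      q x = f₁ x , f₂ x

      adj-∪ : ∀ x y → (A ∪ B) x ≡ true → (A ∪ B) y ≡ false → adj G x y ≡ P x ·₄ h y
      adj-∪ x y ∪∋x ∪∌y with A x in A∋?x
      ... | true  = trans (adj≡₁ x y A∋?x (∨-conicalˡ _ _ ∪∌y)) (sym (xor-identityʳ _))
      ... | false = adj≡₂ x y ∪∋x (∨-conicalʳ _ _ ∪∌y)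

      adj-∩ : ∀ x y → (A ∩ B) x ≡ true → (A ∩ B) y ≡ false → adj G x y ≡ q x ·₄ H y
      adj-∩ x y ∩∋x ∩∌y with A y in A∋?y
      ... | true  = trans (adj≡₂ x y (∧-conicalʳ _ _ ∩∋x) ∩∌y) (cong (_xor f₂ x ·₂ g₂ y) (sym (·₂-zeroʳ (f₁ x))))
      ... | false = trans (adj≡₁ x y (∧-conicalˡ _ _ ∩∋x) A∋?y)
                          (trans (sym (xor-identityʳ _)) (cong (f₁ x ·₂ g₁ y xor_) (sym (·₂-zeroʳ (f₂ x)))))

      q⊥h : ∀ x y → (A ∩ B) x ≡ true → (A ∪ B) y ≡ false → q x ·₄ h y ≡ false
      q⊥h x y ∩∋x ∪∌y = trans (cong₂ _xor_ (sym (adj≡₁ x y (∧-conicalˡ _ _ ∩∋x) (∨-conicalˡ _ _ ∪∌y)))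
                                           (sym (adj≡₂ x y (∧-conicalʳ _ _ ∩∋x) (∨-conicalʳ _ _ ∪∌y))))
                              (xor-same (adj G x y))

      open IndependentColumns (independent-columns (A ∪ B) P h adj-∪ ρ∪≥2)

      b₁ b₂ : GF2⁴
      b₁ = ⊥-basis₁ (h y₁) (h y₂)
      b₂ = ⊥-basis₂ (h y₁) (h y₂)

      coordinates : V → GF2²
      coordinates x = ⊥-coordinates (h y₁) (h y₂) (q x)

      factors : ∀ x y → (A ∩ B) x ≡ true → (A ∩ B) y ≡ false → adj G x y ≡ coordinates x ·₂ (b₁ ·₄ H y , b₂ ·₄ H y)
      factors x y ∩∋x ∩∌y = begin
        adj G x y                             ≡⟨ adj-∩ x y ∩∋x ∩∌y ⟩
        q x ·₄ H y                            ≡⟨ cong (_·₄ H y) q-in-plane ⟩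
        lincomb (coordinates x) b₁ b₂ ·₄ H y  ≡⟨ ·₄-lincomb (coordinates x) b₁ b₂ (H y) ⟩
        coordinates x ·₂ (b₁ ·₄ H y , b₂ ·₄ H y) ∎
        where
          open ≡-Reasoning
          q-in-plane : q x ≡ lincomb (coordinates x) b₁ b₂
          q-in-plane = ⊥-basis-spans (h y₁) (h y₂) (q x) hy₁≢0 hy₂≢0 hy₁≢hy₂ (q⊥h x y₁ ∩∋x U∌y₁) (q⊥h x y₂ ∩∋x U∌y₂)

  cutRank≤2-∩ : ∀ {A B} → CutRankLe G A 2 → CutRankLe G B 2 → ¬ CutRankLe G (A ∪ B) 1 → CutRankLe G (A ∩ B) 2
  cutRank≤2-∩ {A} {B} ρA≤2 ρB≤2 ρ∪≰1 ρ∩≥3 = ρ∪≰1 λ ρ∪≥2 →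
    factorisation⇒cutRank≤2 (A ∩ B)
      (factorisation-∩ A B (cutRank≤2⇒factorisation A ρA≤2) (cutRank≤2⇒factorisation B ρB≤2) ρ∪≥2) ρ∩≥3

  -- Sequential sets

  listSet⇒∈ : ∀ l {v} → listSet G l v ≡ true → v ∈ l
  listSet⇒∈ (x ∷ l) {v} l∋v with x ≟ v
  ... | yes refl = here refl
  ... | no  _    = there (listSet⇒∈ l l∋v)

  ∈⇒listSet : ∀ {l v} → v ∈ l → listSet G l v ≡ true
  ∈⇒listSet {x ∷ l} (here refl) = cong (_∨ listSet G l x) (⁅⁆-self x)
  ∈⇒listSet {x ∷ l} {v} (there v∈l) = trans (cong (⁅ x ⁆ v ∨_) (∈⇒listSet v∈l)) (∨-zeroʳ _)

  listSet-++ : ∀ l m → listSet G (l ++ m) ≗ (listSet G l ∪ listSet G m)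
  listSet-++ []      m v = refl
  listSet-++ (x ∷ l) m v = trans (cong (⁅ x ⁆ v ∨_) (listSet-++ l m v)) (sym (∨-assoc (⁅ x ⁆ v) _ _))

  listSet-take : ∀ j l {v} → listSet G (take j l) v ≡ true → listSet G l v ≡ true
  listSet-take (suc j) (x ∷ l) {v} prefix∋v with x ≟ v
  ... | yes _ = refl
  ... | no  _ = listSet-take j l prefix∋v

  listSet-filter : ∀ z l → listSet G (filter (λ v → ¬? (z ≟ v)) l) ≗ (listSet G l ∖ ⁅ z ⁆)
  listSet-filter z []      v = refl
  listSet-filter z (x ∷ l) v with z ≟ x
  ... | yes refl = trans (listSet-filter z l v) (sym (∨-∧-not (⁅ z ⁆ v) (listSet G l v)))
  ... | no  z≢x with x ≟ v
  ...   | yes refl = sym (cong not (⁅⁆-other z≢x))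
  ...   | no  _    = listSet-filter z l v

  sequential : ∀ {S} l → Unique l → listSet G l ≗ S → (∀ i → CutRankLe G (listSet G (take i l)) 2) → Sequential G S
  sequential l u l≗S prefixes≤2 = l , u ,
    (λ v → mk⇔ (λ S∋v → listSet⇒∈ l (trans (l≗S v) S∋v)) (λ v∈l → trans (sym (l≗S v)) (∈⇒listSet v∈l))) ,
    prefixes≤2

  listSet-sequential : ∀ {S} (s : Sequential G S) → listSet G (proj₁ s) ≗ S
  listSet-sequential {S} (l , _ , l≈S , _) v with listSet G l v in l∋?v | S v in S∋?v
  ... | true  | true  = refl
  ... | false | false = refl
  ... | true  | false = contradiction (trans (sym (Equivalence.from (l≈S v) (listSet⇒∈ l l∋?v))) S∋?v) λ ()
  ... | false | true  = contradiction (trans (sym (∈⇒listSet (Equivalence.to (l≈S v) S∋?v))) l∋?v) λ ()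

  sequential-≗ : ∀ {X Y} → X ≗ Y → Sequential G X → Sequential G Y
  sequential-≗ X≗Y s@(l , u , _ , prefixes≤2) =
    sequential l u (λ v → trans (listSet-sequential s v) (X≗Y v)) prefixes≤2

  cutRank≤2-atMostOne : ∀ {X} v → (∀ w → X w ≡ true → w ≡ v) → CutRankLe G X 2
  cutRank≤2-atMostOne {X} v X⊆v (r , r⊆X , ind)
    with y , sum≡true ← ind (true ∷ᶠ true ∷ᶠ false ∷ᶠ []ᶠ) (zero , refl) = contradiction (begin
      true                                              ≡⟨ sym sum≡true ⟩
      cutRow G X (r zero) y xor (cutRow G X (r (suc zero)) y xor false)
        ≡⟨ cong₂ (λ a b → cutRow G X a y xor (cutRow G X b y xor false))
                 (X⊆v _ (r⊆X zero)) (X⊆v _ (r⊆X (suc zero))) ⟩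
      cutRow G X v y xor (cutRow G X v y xor false)     ≡⟨ cong (cutRow G X v y xor_) (xor-identityʳ _) ⟩
      cutRow G X v y xor cutRow G X v y                 ≡⟨ xor-same (cutRow G X v y) ⟩
      false                                             ∎) λ ()
    where open ≡-Reasoning

  sequential-∅ : ∀ {S} → (∀ w → S w ≡ false) → Sequential G S
  sequential-∅ S≡∅ = sequential [] [] (λ w → sym (S≡∅ w))
    λ i (r , r⊆prefix , _) → contradiction (listSet-take i [] (r⊆prefix zero)) λ ()

  sequential-singleton : ∀ {S} v → S v ≡ true → (∀ w → S w ≡ true → w ≡ v) → Sequential G S
  sequential-singleton {S} v S∋v S⊆v = sequential (v ∷ []) ([] ∷ []) [v]≗S
    λ i → cutRank≤2-atMostOne v λ w prefix∋w → member (listSet⇒∈ (v ∷ []) (listSet-take i (v ∷ []) prefix∋w))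
    where
      member : ∀ {w} → w ∈ v ∷ [] → w ≡ v
      member (here w≡v) = w≡v

      [v]≗S : listSet G (v ∷ []) ≗ S
      [v]≗S w with v ≟ w
      ... | yes refl = sym S∋v
      ... | no  v≢w  = sym (¬-not λ S∋w → v≢w (sym (S⊆v w S∋w)))

  nonsequential⇒atLeastTwo : ∀ {S} → ¬ Sequential G S → AtLeastTwo G S
  nonsequential⇒atLeastTwo {S} ¬seq with any? (λ v → S v ≟ᵇ true)
  ... | no  S≡∅ = contradiction (sequential-∅ λ w → ¬-not λ S∋w → S≡∅ (w , S∋w)) ¬seq
  ... | yes (v , S∋v) with any? (λ w → (S w ≟ᵇ true) ×-dec ¬? (w ≟ v))
  ...   | yes (w , S∋w , w≢v) = w , v , w≢v , S∋w , S∋v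
  ...   | no  S⊆v = contradiction (sequential-singleton v S∋v λ w S∋w →
                                     decidable-stable (w ≟ v) λ w≢v → S⊆v (w , S∋w , w≢v)) ¬seq

  sequential-insert : ∀ {S t} → Sequential G S → S t ≡ false → CutRankLe G (S ∪ ⁅ t ⁆) 2 → Sequential G (S ∪ ⁅ t ⁆)
  sequential-insert {S} {t} s@(l , u , l≈S , prefixes≤2) S∌t ρ≤2 =
    sequential (l ++ t ∷ []) (Unique.++⁺ u ([] ∷ []) t∉l) l∷ʳt≗ prefixes′
    where
      t∉l : ∀ {v} → ¬ (v ∈ l × v ∈ t ∷ [])
      t∉l (t∈l , here refl) = contradiction (trans (sym (Equivalence.from (l≈S t) t∈l)) S∌t) λ ()

      l∷ʳt≗ : listSet G (l ++ t ∷ []) ≗ (S ∪ ⁅ t ⁆)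
      l∷ʳt≗ v = trans (listSet-++ l (t ∷ []) v) (cong₂ _∨_ (listSet-sequential s v) (∨-identityʳ _))

      prefixes′ : ∀ i → CutRankLe G (listSet G (take i (l ++ t ∷ []))) 2
      prefixes′ i with take-∷ʳ i l t
      ... | inj₁ eq rewrite eq = prefixes≤2 i
      ... | inj₂ eq rewrite eq = cutRankLe-≗ (λ v → sym (l∷ʳt≗ v)) ρ≤2

  -- Deleting z from an ordering of Z keeps prefixes of cut-rank ≤ 2: a prefix P ∋ z
  -- loses z as P ∩ (Z ∖ {z}), and P ∪ (Z ∖ {z}) = Z has cut-rank ≥ 2.
  sequential-remove : ∀ {Z z} → Sequential G Z → CutRankLe G (Z ∖ ⁅ z ⁆) 2 → ¬ CutRankLe G Z 1 →
    Sequential G (Z ∖ ⁅ z ⁆)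
  sequential-remove {Z} {z} s@(l , u , _ , prefixes≤2) ρ≤2 ρZ≰1 =
    sequential (filter z∉? l) (Unique.filter⁺ z∉? u) l′≗ prefixes′
    where
      z∉? : ∀ v → Dec (z ≢ v)
      z∉? v = ¬? (z ≟ v)

      l′≗ : listSet G (filter z∉? l) ≗ (Z ∖ ⁅ z ⁆)
      l′≗ v = trans (listSet-filter z l v) (cong (_∧ not (⁅ z ⁆ v)) (listSet-sequential s v))

      prefix∖z≤2 : ∀ j → CutRankLe G (listSet G (take j l) ∖ ⁅ z ⁆) 2
      prefix∖z≤2 j with listSet G (take j l) z ≟ᵇ true
      ... | no  P∌z = cutRankLe-≗ (λ v → sym (∖-⁅⁆-∉ {P = listSet G (take j l)} (¬-not P∌z) v)) (prefixes≤2 j)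
      ... | yes P∋z = cutRankLe-≗ (∩-∖ P⊆Z) (cutRank≤2-∩ (prefixes≤2 j) ρ≤2 λ ρ∪≤1 →
                        ρZ≰1 (cutRankLe-≗ (∪-∖ P⊆Z (⁅⁆-⊆ P∋z)) ρ∪≤1))
        where
          P⊆Z : listSet G (take j l) ⊆ Z
          P⊆Z P∋v = trans (sym (listSet-sequential s _)) (listSet-take j l P∋v)

      prefixes′ : ∀ i → CutRankLe G (listSet G (take i (filter z∉? l))) 2
      prefixes′ i with j , eq ← take-filter z∉? i l rewrite eq =
        cutRankLe-≗ (λ v → sym (listSet-filter z (take j l) v)) (prefix∖z≤2 j)

  -- An ordering has no repetitions, so only lists of length at most |V| need to be searched.
  sequential? : ∀ S → Dec (Sequential G S)
  sequential? S =
    map′ (λ (_ , l , _ , u , l≗S , prefixes≤2) → sequential l u l≗S prefixes≤2)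
         (λ s@(l , u , _ , prefixes≤2) →
            fromℕ< (s≤s (unique-length≤ u)) , l , sym (toℕ-fromℕ< _) , u , listSet-sequential s , prefixes≤2)
         (any? λ k → ∃-list-of-length? (toℕ k) λ l →
            UniqueDec.unique? _≟_ l ×-dec all? (λ v → listSet G l v ≟ᵇ S v) ×-dec
            all-prefixes? (λ m → cutRank≤2? (listSet G m)) l)

  -- Non-sequential separations

  tripleSet-∋ : (T : Fin 3 → V) → ∀ a → tripleSet G T (T a) ≡ true
  tripleSet-∋ T zero             = ∨-introˡ (⁅⁆-self (T zero))
  tripleSet-∋ T (suc zero)       = ∨-introʳ {⁅ T zero ⁆ _} (∨-introˡ (⁅⁆-self (T (suc zero))))
  tripleSet-∋ T (suc (suc zero)) =
    ∨-introʳ {⁅ T zero ⁆ _} (∨-introʳ {⁅ T (suc zero) ⁆ _} (⁅⁆-self (T (suc (suc zero)))))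

  tripleSet-member : (T : Fin 3 → V) → ∀ {v} → tripleSet G T v ≡ true → ∃ λ a → T a ≡ v
  tripleSet-member T {v} T∋v with T zero ≟ v | T (suc zero) ≟ v | T (suc (suc zero)) ≟ v
  ... | yes eq | _      | _      = zero , eq
  ... | no _   | yes eq | _      = suc zero , eq
  ... | no _   | no _   | yes eq = suc (suc zero) , eq
  ... | no _   | no _   | no _   = contradiction T∋v λ ()

  NonsequentialCut : VSet G → Set
  NonsequentialCut X = CutRankLe G X 2 × ¬ Sequential G X × ¬ Sequential G (complement G X)

  nonsequentialCut-≗ : ∀ {X Y} → X ≗ Y → NonsequentialCut X → NonsequentialCut Y
  nonsequentialCut-≗ X≗Y (ρ≤2 , ¬seq , ¬seq̅) =
    cutRankLe-≗ X≗Y ρ≤2 , (λ seq → ¬seq (sequential-≗ (λ v → sym (X≗Y v)) seq)) ,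
    λ seq̅ → ¬seq̅ (sequential-≗ (λ v → cong not (sym (X≗Y v))) seq̅)

  nonsequentialCut-complement : ∀ {X} → NonsequentialCut X → NonsequentialCut (complement G X)
  nonsequentialCut-complement {X} (ρ≤2 , ¬seq , ¬seq̅) =
    cutRank≤2-complement X ρ≤2 , ¬seq̅ , λ seq → ¬seq (sequential-≗ (λ v → not-involutive (X v)) seq)

  nonsequentialCut? : ∀ X → Dec (NonsequentialCut X)
  nonsequentialCut? X = cutRank≤2? X ×-dec ¬? (sequential? X) ×-dec ¬? (sequential? (complement G X))

  nonsequentialCut-exists : Prime G → ¬ Seq3RankConnected G → Σ (VSet G) NonsequentialCut
  nonsequentialCut-exists prime ¬connected with anySubset? (λ s → nonsequentialCut? (lookup s))
  ... | yes (s , cut) = lookup s , cut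
  ... | no  none      = contradiction (prime , cuts-sequential) ¬connected
    where
      cuts-sequential : ∀ X → CutRankLe G X 2 → Sequential G X ⊎ Sequential G (complement G X)
      cuts-sequential X ρ≤2 with sequential? X | sequential? (complement G X)
      ... | yes seq | _        = inj₁ seq
      ... | no  _   | yes seq̅  = inj₂ seq̅
      ... | no ¬seq | no ¬seq̅ =
        contradiction (tabulate X , nonsequentialCut-≗ (λ v → sym (lookup∘tabulate X v)) (ρ≤2 , ¬seq , ¬seq̅)) none

  -- Primeness gives ρ(X ∩ S) ≥ 2 (s₁, s₂ on one side; t and a second vertex of V − X on the
  -- other), so submodularity bounds ρ((V − X) ∩ (V − S)) = ρ(V − (X ∪ {t})).
  cutRank≤2-absorb : Prime G → ∀ {X S t s₁ s₂} → CutRankLe G X 2 → AtLeastTwo G (complement G X) →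
    CutRankLe G S 2 → s₁ ≢ s₂ → (X ∩ S) s₁ ≡ true → (X ∩ S) s₂ ≡ true → X t ≡ false → S t ≡ true →
    S ⊆ (X ∪ ⁅ t ⁆) → CutRankLe G (X ∪ ⁅ t ⁆) 2
  cutRank≤2-absorb prime {X} {S} {t} {s₁} {s₂} ρX≤2 (w₁ , w₂ , w₁≢w₂ , X̅∋w₁ , X̅∋w₂) ρS≤2
                   s₁≢s₂ X∩S∋s₁ X∩S∋s₂ X∌t S∋t S⊆X∪t =
    cutRankLe-≗ X∪S≗X∪t (cutRank≤2-complement _
      (cutRank≤2-∩ (cutRank≤2-complement X ρX≤2) (cutRank≤2-complement S ρS≤2) λ ρ≤1 →
        prime (complement G (X ∩ S) , two-outside , two-inside , cutRankLe-≗ (λ v → sym (deMorgan₁ (X v) (S v))) ρ≤1)))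
    where
      X∪S≗X∪t : complement G (complement G X ∩ complement G S) ≗ (X ∪ ⁅ t ⁆)
      X∪S≗X∪t v = trans (deMorgan₁ (not (X v)) (not (S v)))
        (trans (cong₂ _∨_ (not-involutive (X v)) (not-involutive (S v)))
               (∪-absorbs {X = X} {S} {⁅ t ⁆} S⊆X∪t (⁅⁆-⊆ {P = S} S∋t) v))

      outside-X : ∀ {w} → X w ≡ false → complement G (X ∩ S) w ≡ true
      outside-X {w} X∌w = cong (λ b → not (b ∧ S w)) X∌w

      two-outside : AtLeastTwo G (complement G (X ∩ S))
      two-outside with w₁ ≟ t
      ... | yes refl = t , w₂ , w₁≢w₂ , outside-X X∌t , outside-X (not-injective X̅∋w₂)
      ... | no w₁≢t  = t , w₁ , (λ t≡w₁ → w₁≢t (sym t≡w₁)) , outside-X X∌t , outside-X (not-injective X̅∋w₁)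

      two-inside : AtLeastTwo G (complement G (complement G (X ∩ S)))
      two-inside = s₁ , s₂ , s₁≢s₂ , trans (not-involutive _) X∩S∋s₁ , trans (not-involutive _) X∩S∋s₂

  nonsequentialCut-absorb : Prime G → ∀ {X S t s₁ s₂} → NonsequentialCut X → CutRankLe G S 2 → s₁ ≢ s₂ →
    (X ∩ S) s₁ ≡ true → (X ∩ S) s₂ ≡ true → X t ≡ false → S t ≡ true → S ⊆ (X ∪ ⁅ t ⁆) →
    NonsequentialCut (X ∪ ⁅ t ⁆)
  nonsequentialCut-absorb prime {X} {S} {t} {s₁} {s₂} (ρX≤2 , ¬seq , ¬seq̅) ρS≤2
                          s₁≢s₂ X∩S∋s₁ X∩S∋s₂ X∌t S∋t S⊆X∪t =
    cutRank≤2-absorb prime ρX≤2 (nonsequential⇒atLeastTwo ¬seq̅) ρS≤2 s₁≢s₂ X∩S∋s₁ X∩S∋s₂ X∌t S∋t S⊆X∪t ,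
    ¬seq′ , ¬seq̅′
    where
      X∪t∋ : ∀ {v} → X v ≡ true ⊎ t ≡ v → (X ∪ ⁅ t ⁆) v ≡ true
      X∪t∋ (inj₁ X∋v)  = ∨-introˡ X∋v
      X∪t∋ (inj₂ refl) = ∨-introʳ (⁅⁆-self t)

      two-in-X∪t : AtLeastTwo G (X ∪ ⁅ t ⁆)
      two-in-X∪t = s₁ , s₂ , s₁≢s₂ , X∪t∋ (inj₁ (∧-conicalˡ _ _ X∩S∋s₁)) , X∪t∋ (inj₁ (∧-conicalˡ _ _ X∩S∋s₂))

      removed : ((X ∪ ⁅ t ⁆) ∖ ⁅ t ⁆) ≗ X
      removed = ∪-⁅⁆-∖-⁅⁆ {X = X} X∌t

      reinserted : (complement G (X ∪ ⁅ t ⁆) ∪ ⁅ t ⁆) ≗ complement G X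
      reinserted = ∁-∪-⁅⁆-∪-⁅⁆ {X = X} X∌t

      ¬seq̅′ : ¬ Sequential G (complement G (X ∪ ⁅ t ⁆))
      ¬seq̅′ seq̅′ = ¬seq̅ (sequential-≗ reinserted (sequential-insert seq̅′ (cong not (X∪t∋ (inj₂ refl)))
        (cutRankLe-≗ (λ v → sym (reinserted v)) (cutRank≤2-complement X ρX≤2))))

      ¬seq′ : ¬ Sequential G (X ∪ ⁅ t ⁆)
      ¬seq′ seq′ = ¬seq (sequential-≗ removed (sequential-remove seq′
        (cutRankLe-≗ (λ v → sym (removed v)) ρX≤2) λ ρ≤1 →
          prime (X ∪ ⁅ t ⁆ , two-in-X∪t , nonsequential⇒atLeastTwo ¬seq̅′ , ρ≤1)))

  Uniform : VSet G → (Fin 3 → V) → Set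
  Uniform A T = (∀ a → A (T a) ≡ true) ⊎ (∀ a → A (T a) ≡ false)

  AgreesUpToComplementAwayFrom : V → VSet G → VSet G → Set
  AgreesUpToComplementAwayFrom u A′ A = (∀ v → u ≢ v → A′ v ≡ A v) ⊎ (∀ v → u ≢ v → A′ v ≡ not (A v))

  uniform-away : ∀ {A A′ u} T → (∀ a → u ≢ T a) → AgreesUpToComplementAwayFrom u A′ A → Uniform A T → Uniform A′ T
  uniform-away T u∉T (inj₁ same) (inj₁ all)  = inj₁ λ a → trans (same _ (u∉T a)) (all a)
  uniform-away T u∉T (inj₁ same) (inj₂ none) = inj₂ λ a → trans (same _ (u∉T a)) (none a)
  uniform-away T u∉T (inj₂ flip) (inj₁ all)  = inj₂ λ a → trans (flip _ (u∉T a)) (cong not (all a))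
  uniform-away T u∉T (inj₂ flip) (inj₂ none) = inj₁ λ a → trans (flip _ (u∉T a)) (cong not (none a))

  absorb-odd-one-out : Prime G → ∀ {X} (T : Fin 3 → V) → (∀ a b → T a ≡ T b → a ≡ b) →
    CutRankLe G (tripleSet G T) 2 → NonsequentialCut X →
    ∀ k → X (T k) ≡ false → (∀ j → X (T (punchIn k j)) ≡ true) →
    NonsequentialCut (X ∪ ⁅ T k ⁆) × (∀ a → (X ∪ ⁅ T k ⁆) (T a) ≡ true)
  absorb-odd-one-out prime {X} T T-injective ρT≤2 cut k X∌Tk others =
    nonsequentialCut-absorb prime cut ρT≤2 Ts≢Ts′ (X∩T∋ zero) (X∩T∋ (suc zero)) X∌Tk (tripleSet-∋ T k) T⊆X∪Tk ,
    covered
    where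
      covered : ∀ a → (X ∪ ⁅ T k ⁆) (T a) ≡ true
      covered a with k ≟ a
      ... | yes refl = ∨-introʳ (⁅⁆-self (T k))
      ... | no  k≢a  = ∨-introˡ (subst (λ b → X (T b) ≡ true) (punchIn-punchOut k≢a) (others (punchOut k≢a)))

      T⊆X∪Tk : tripleSet G T ⊆ (X ∪ ⁅ T k ⁆)
      T⊆X∪Tk T∋v with a , refl ← tripleSet-member T T∋v = covered a

      X∩T∋ : ∀ j → (X ∩ tripleSet G T) (T (punchIn k j)) ≡ true
      X∩T∋ j = cong₂ _∧_ (others j) (tripleSet-∋ T (punchIn k j))

      Ts≢Ts′ : T (punchIn k zero) ≢ T (punchIn k (suc zero))
      Ts≢Ts′ eq with () ← punchIn-injective k zero (suc zero) (T-injective _ _ eq)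

  uniformise-triple : Prime G → ∀ {X} (T : Fin 3 → V) → (∀ a b → T a ≡ T b → a ≡ b) →
    CutRankLe G (tripleSet G T) 2 → NonsequentialCut X → Σ (VSet G) λ X′ → NonsequentialCut X′ × Uniform X′ T ×
      ∃ λ k → AgreesUpToComplementAwayFrom (T k) X′ X
  uniformise-triple prime {X} T T-injective ρT≤2 cut with odd-one-out (λ a → X (T a))
  ... | inj₁ all         = X , cut , inj₁ all , zero , inj₁ λ _ _ → refl
  ... | inj₂ (inj₁ none) = X , cut , inj₂ none , zero , inj₁ λ _ _ → refl
  ... | inj₂ (inj₂ (k , others)) with X (T k) ≟ᵇ true
  ...   | no  X∌Tk =
    let cut′ , covered = absorb-odd-one-out prime T T-injective ρT≤2 cut k (¬-not X∌Tk)
                           λ j → trans (others j) (cong not (¬-not X∌Tk)) in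
    X ∪ ⁅ T k ⁆ , cut′ , inj₁ covered , k , inj₁ λ v Tk≢v → ∪-⁅⁆-other {X = X} Tk≢v
  ...   | yes X∋Tk =
    let cut′ , covered = absorb-odd-one-out prime T T-injective ρT≤2 (nonsequentialCut-complement cut)
                           k (cong not X∋Tk)
                           λ j → cong not (trans (others j) (cong not X∋Tk)) in
    complement G X ∪ ⁅ T k ⁆ , cut′ , inj₁ covered , k , inj₂ λ v Tk≢v → ∪-⁅⁆-other {X = complement G X} Tk≢v

  uniformise-triples : Prime G → ∀ {n} (T : Fin n → Fin 3 → V) → (∀ i j a b → T i a ≡ T j b → i ≡ j × a ≡ b) →
    (∀ i → CutRankLe G (tripleSet G (T i)) 2) → ∀ {X} → NonsequentialCut X →
    Σ (VSet G) λ A → NonsequentialCut A × ∀ i → Uniform A (T i)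
  uniformise-triples prime {zero} T T-injective ρT≤2 cut = _ , cut , λ ()
  uniformise-triples prime {suc n} T T-injective ρT≤2 cut
    with A , cutA , uniformA ← uniformise-triples prime (λ i → T (suc i))
           (λ i j a b eq → let i≡j , a≡b = T-injective _ _ a b eq in suc-injective i≡j , a≡b)
           (λ i → ρT≤2 (suc i)) cut
    with A′ , cutA′ , uniform₀ , k , agrees ← uniformise-triple prime (T zero)
           (λ a b eq → proj₂ (T-injective _ _ a b eq)) (ρT≤2 zero) cutA
    = A′ , cutA′ , λ { zero → uniform₀ ; (suc i) → uniform-away (T (suc i)) (T₀∉ i) agrees (uniformA i) }
    where
      T₀∉ : ∀ i a → T zero k ≢ T (suc i) a
      T₀∉ i a eq with () ← proj₁ (T-injective _ _ _ _ eq)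

lemma3p2 : (G : Graph) → Prime G → ¬ Seq3RankConnected G →
    (n : ℕ) → (T : Fin n → Fin 3 → Fin (N G)) →
    (∀ i j a b → T i a ≡ T j b → (i ≡ j × a ≡ b)) →
    (∀ i → CutRankEq G (tripleSet G (T i)) 2) →
    Σ (VSet G) λ A →
    CutRankLe G A 2 × ¬ Sequential G A × ¬ Sequential G (complement G A) ×
    (∀ i → (∀ a → A (T i a) ≡ true) ⊎ (∀ a → A (T i a) ≡ false))
-- Only the upper bound ρ(Tᵢ) ≤ 2 is used.
lemma3p2 G prime ¬connected n T T-injective ρT≡2 =
  let X , cut = nonsequentialCut-exists G prime ¬connected
      A , (ρA≤2 , ¬seq , ¬seq̅) , uniform = uniformise-triples G prime T T-injective (λ i → proj₂ (ρT≡2 i)) cut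
  in A , ρA≤2 , ¬seq , ¬seq̅ , uniform
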